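{- Let $m$ be a positive integer and let $A_0=I_m, A_1, A_2$ be the adjacency matrices of a non-symmetric association scheme of class $2$ on $m$ points (so $A_2=A_1^\top$). Let $\mathbf{1}$ denote the all-one row vector of length $m$, and define the $2(m+1)\times 2(m+1)$ matrices, written in block form with respect to a partition of the index set into consecutive blocks of sizes $1,m,m,1$: \[ C_0=I_{2(m+1)},\qquad C_1=\begin{bmatrix} 0&\mathbf{1}&0&0 \\ 0&A_1&A_2&\mathbf{1}^\top \\ \mathbf{1}^\top&A_2&A_1&0 \\ 0&0&\mathbf{1}&0 \end{bmatrix},\qquad C_2=C_1^\top,\qquad C_3=J-C_0-C_1-C_2, \] where $J$ is the all-one matrix of size $2(m+1)$. Then \begin{align*} C_1^2&=C_2^2=\tfrac{m-1}{2}(C_1+C_2)+mC_3,\\ C_1C_2&=C_2C_1=mC_0+\tfrac{m-1}{2}(C_1+ C_2),\\ C_1C_3&=C_3C_1=C_2,\\ C_2C_3&=C_3C_2= C_1,\\ C_3^2&=C_0. \end{align*}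
   Context: A (commutative) association scheme of class $d$ on a finite set $X$ with $|X|=n$ is given by $0/1$ matrices $A_0=I_n,A_1,\dots,A_d$ (adjacency matrices) with $\sum_{i} A_i=J$, the set $\{A_i\}$ closed under transposition, and the linear span $\langle A_0,\dots,A_d\rangle$ closed under matrix multiplication and commutative. It is non-symmetric if some $A_i$ is not symmetric. For a non-symmetric association scheme of class $2$ on $m$ points, $A_2=A_1^\top$, and necessarily $m\equiv 3\pmod 4$. -}

module Defs where

open import Data.Nat as ℕ using (ℕ; zero; suc; _∸_)
open import Data.Integer as ℤ using (ℤ; +_; 0ℤ; 1ℤ)
open import Data.Fin using (Fin; zero; suc; splitAt; _≟_)
open import Data.Sum using (_⊎_; inj₁; inj₂)
open import Data.Product using (Σ; ∃; _×_; _,_)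
open import Relation.Nullary using (¬_; yes; no)
open import Relation.Binary.PropositionalEquality using (_≡_)

Mat : ℕ → Set
Mat n = Fin n → Fin n → ℤ

sumFin : ∀ {n} → (Fin n → ℤ) → ℤ
sumFin {zero}  f = 0ℤ
sumFin {suc n} f = f zero ℤ.+ sumFin (λ i → f (suc i))

_⊗_ : ∀ {n} → Mat n → Mat n → Mat n
(A ⊗ B) i j = sumFin (λ k → A i k ℤ.* B k j)
infixl 7 _⊗_

_⊕_ : ∀ {n} → Mat n → Mat n → Mat n
(A ⊕ B) i j = A i j ℤ.+ B i j
infixl 6 _⊕_

_⊖_ : ∀ {n} → Mat n → Mat n → Mat n
(A ⊖ B) i j = A i j ℤ.- B i j
infixl 6 _⊖_

_·_ : ∀ {n} → ℤ → Mat n → Mat n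
(c · A) i j = c ℤ.* A i j
infixl 7 _·_

transpose : ∀ {n} → Mat n → Mat n
transpose A i j = A j i

_≐_ : ∀ {n} → Mat n → Mat n → Set
A ≐ B = ∀ i j → A i j ≡ B i j
infix 4 _≐_

I : ∀ {n} → Mat n
I i j with i ≟ j
... | yes _ = 1ℤ
... | no  _ = 0ℤ

J : ∀ {n} → Mat n
J i j = 1ℤ

Zero : ∀ {n} → Mat n
Zero i j = 0ℤ

IsZeroOne : ∀ {n} → Mat n → Set
IsZeroOne A = ∀ i j → (A i j ≡ 0ℤ) ⊎ (A i j ≡ 1ℤ)

sumMat : ∀ {n d} → (Fin d → Mat n) → Mat n
sumMat {d = zero}  A = Zero
sumMat {d = suc d} A = A zero ⊕ sumMat (λ i → A (suc i))

lincomb : ∀ {n d} → (Fin d → ℤ) → (Fin d → Mat n) → Mat n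
lincomb c A = sumMat (λ i → c i · A i)

record IsAssocScheme (n d : ℕ) (A : Fin (suc d) → Mat n) : Set where
  field
    zeroOne     : ∀ i → IsZeroOne (A i)
    identity    : A zero ≐ I
    sumJ        : sumMat A ≐ J
    transClosed : ∀ i → ∃ λ j → transpose (A i) ≐ A j
    mulClosed   : ∀ i j → ∃ λ (c : Fin (suc d) → ℤ) → A i ⊗ A j ≐ lincomb c A
    commutative : ∀ i j → A i ⊗ A j ≐ A j ⊗ A i

NonSymmetric : ∀ {n d} → (Fin (suc d) → Mat n) → Set
NonSymmetric A = ∃ λ i → ¬ (transpose (A i) ≐ A i)

N : ℕ → ℕ
N m = 1 ℕ.+ (m ℕ.+ (m ℕ.+ 1))

data Block (m : ℕ) : Set where
  bA : Block m
  bB : Fin m → Block m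
  bC : Fin m → Block m
  bD : Block m

block : ∀ {m} → Fin (N m) → Block m
block {m} i with splitAt 1 i
... | inj₁ _ = bA
... | inj₂ k with splitAt m k
... | inj₁ x = bB x
... | inj₂ l with splitAt m l
... | inj₁ y = bC y
... | inj₂ _ = bD

C1blk : ∀ {m} → Mat m → Mat m → Block m → Block m → ℤ
C1blk A₁ A₂ bA     (bB _) = 1ℤ
C1blk A₁ A₂ (bB x) (bB y) = A₁ x y
C1blk A₁ A₂ (bB x) (bC y) = A₂ x y
C1blk A₁ A₂ (bB _) bD     = 1ℤ
C1blk A₁ A₂ (bC _) bA     = 1ℤ
C1blk A₁ A₂ (bC x) (bB y) = A₂ x y
C1blk A₁ A₂ (bC x) (bC y) = A₁ x y
C1blk A₁ A₂ bD     (bC _) = 1ℤ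
C1blk A₁ A₂ _      _      = 0ℤ

C1 : ∀ {m} → Mat m → Mat m → Mat (N m)
C1 {m} A₁ A₂ i j = C1blk A₁ A₂ (block {m} i) (block {m} j)

C2 : ∀ {m} → Mat m → Mat m → Mat (N m)
C2 {m} A₁ A₂ = transpose (C1 {m} A₁ A₂)

C0 : ∀ {m} → Mat (N m)
C0 {m} = I {N m}

C3 : ∀ {m} → Mat m → Mat m → Mat (N m)
C3 {m} A₁ A₂ = J ⊖ C0 {m} ⊖ C1 {m} A₁ A₂ ⊖ C2 {m} A₁ A₂

{-# OPTIONS --safe #-}
-- A non-symmetric 2-class scheme is a doubly regular tournament: since A₁A₂ = A₁A₁ᵀ is
-- symmetric while A₁ is not, A₁A₂ = kI + λ(A₁ + A₂), where k is the common row sum,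
-- m = 2k + 1 and k = 2λ + 1. Hence A₁A₂ + A₂A₁ + J = k(A₁ + A₂) + mI and, as
-- (A₁ + A₂)(A₁ + A₂ + I) = 2kJ, also A₁² + A₂² = k(A₁ + A₂).
-- In the construction, C₃ is the permutation matrix of the involution that swaps the first
-- and the last index and swaps the two middle blocks pointwise; this involution turns C₁
-- into C₁ᵀ, which yields every relation involving C₃. The square C₁² is computed blockwise from
-- the two tournament identities, C₂² is its transpose, and C₁C₂ = C₁²C₃, C₂C₁ = C₂²C₃.
module Submission where

open import Defs
open import Data.Nat using (ℕ; suc; _∸_; _/_; _≤_)
open import Data.Integer using (ℤ; +_)
open import Data.Fin using (Fin; zero; suc)
open import Data.Product using (_×_)

open import Algebra.Properties.Semiring.Sum as Sum using ()
open import Data.Fin using (_↑ˡ_; _↑ʳ_; _≟_; splitAt; join; fromℕ<)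
open import Data.Fin.Patterns using (0F; 1F; 2F)
open import Data.Fin.Properties using (suc-injective; splitAt-↑ˡ; splitAt-↑ʳ; join-splitAt)
open import Data.Integer using (-[1+_]; 0ℤ; 1ℤ; _+_; _*_; _-_)
import Data.Integer.Properties as ℤ
open import Data.Integer.Tactic.RingSolver using (solve-∀)
open import Data.Nat as ℕ using (zero)
open import Data.Nat.DivMod using (m*n/n≡m)
import Data.Nat.Properties as ℕ
open import Data.Product using (_,_; proj₁; proj₂)
open import Data.Sum using (_⊎_; inj₁; inj₂)
open import Function using (_∘_)
open import Level using (0ℓ)
open import Relation.Binary.Bundles using (Setoid)
open import Relation.Binary.PropositionalEquality hiding (J)
open import Relation.Nullary using (¬_; Dec; yes; no; contradiction)

open Sum ℤ.+-*-semiring using (sum; ∑-distrib-+; ∑-comm; *-distribˡ-sum; *-distribʳ-sum)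

-- Finite sums

sumFin≡sum : ∀ {n} (f : Fin n → ℤ) → sumFin f ≡ sum f
sumFin≡sum {zero}  f = refl
sumFin≡sum {suc n} f = cong (_+_ (f zero)) (sumFin≡sum (f ∘ suc))

sumFin-cong : ∀ {n} {f g : Fin n → ℤ} → (∀ i → f i ≡ g i) → sumFin f ≡ sumFin g
sumFin-cong {zero}  f≗g = refl
sumFin-cong {suc n} f≗g = cong₂ _+_ (f≗g zero) (sumFin-cong (f≗g ∘ suc))

sumFin-+ : ∀ {n} (f g : Fin n → ℤ) → sumFin (λ i → f i + g i) ≡ sumFin f + sumFin g
sumFin-+ f g = trans (sumFin≡sum (λ i → f i + g i))
  (trans (∑-distrib-+ f g) (sym (cong₂ _+_ (sumFin≡sum f) (sumFin≡sum g))))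

sumFin-*ˡ : ∀ {n} c (f : Fin n → ℤ) → sumFin (λ i → c * f i) ≡ c * sumFin f
sumFin-*ˡ c f = trans (sumFin≡sum (λ i → c * f i))
  (trans (sym (*-distribˡ-sum c f)) (cong (c *_) (sym (sumFin≡sum f))))

sumFin-*ʳ : ∀ {n} c (f : Fin n → ℤ) → sumFin (λ i → f i * c) ≡ sumFin f * c
sumFin-*ʳ c f = trans (sumFin≡sum (λ i → f i * c))
  (trans (sym (*-distribʳ-sum c f)) (cong (_* c) (sym (sumFin≡sum f))))

sumFin-swap : ∀ {m n} (f : Fin m → Fin n → ℤ) →
              sumFin (λ i → sumFin (f i)) ≡ sumFin (λ j → sumFin (λ i → f i j))
sumFin-swap f = begin
  sumFin (λ i → sumFin (f i))             ≡⟨ sumFin-cong (λ i → sumFin≡sum (f i)) ⟩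
  sumFin (λ i → sum (f i))                ≡⟨ sumFin≡sum (λ i → sum (f i)) ⟩
  sum (λ i → sum (f i))                   ≡⟨ ∑-comm f ⟩
  sum (λ j → sum (λ i → f i j))           ≡⟨ sumFin≡sum (λ j → sum (λ i → f i j)) ⟨
  sumFin (λ j → sum (λ i → f i j))        ≡⟨ sumFin-cong (λ j → sumFin≡sum (λ i → f i j)) ⟨
  sumFin (λ j → sumFin (λ i → f i j))     ∎
  where open ≡-Reasoning

sumFin-0 : ∀ {n} → sumFin {n} (λ _ → 0ℤ) ≡ 0ℤ
sumFin-0 {zero}  = refl
sumFin-0 {suc n} = trans (ℤ.+-identityˡ _) (sumFin-0 {n})

sumFin-1 : ∀ {n} → sumFin {n} (λ _ → 1ℤ) ≡ + n
sumFin-1 {zero}  = refl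
sumFin-1 {suc n} = cong (_+_ 1ℤ) (sumFin-1 {n})

sumFin-↑ : ∀ m n (f : Fin (m ℕ.+ n) → ℤ) →
           sumFin f ≡ sumFin (f ∘ (_↑ˡ n)) + sumFin (f ∘ (m ↑ʳ_))
sumFin-↑ zero    n f = sym (ℤ.+-identityˡ _)
sumFin-↑ (suc m) n f = trans (cong (_+_ (f zero)) (sumFin-↑ m n (f ∘ suc)))
                             (sym (ℤ.+-assoc (f zero) _ _))

I-diag : ∀ {n} (x : Fin n) → I x x ≡ 1ℤ
I-diag x with x ≟ x
... | yes _   = refl
... | no x≢x = contradiction refl x≢x

I-offDiag : ∀ {n} {x y : Fin n} → x ≢ y → I x y ≡ 0ℤ
I-offDiag {x = x} {y} x≢y with x ≟ y
... | yes x≡y = contradiction x≡y x≢y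
... | no _    = refl

I-sym : ∀ {n} (x y : Fin n) → I x y ≡ I y x
I-sym x y = by-cases (x ≟ y)
  where
  by-cases : Dec (x ≡ y) → I x y ≡ I y x
  by-cases (yes refl) = refl
  by-cases (no x≢y)   = trans (I-offDiag x≢y) (sym (I-offDiag (x≢y ∘ sym)))

I-suc : ∀ {n} (x y : Fin n) → I {suc n} (suc x) (suc y) ≡ I x y
I-suc x y = by-cases (x ≟ y)
  where
  by-cases : Dec (x ≡ y) → I (suc x) (suc y) ≡ I x y
  by-cases (yes refl) = trans (I-diag (suc x)) (sym (I-diag x))
  by-cases (no x≢y)   = trans (I-offDiag (x≢y ∘ suc-injective)) (sym (I-offDiag x≢y))

sumFin-δˡ : ∀ {n} (x : Fin n) (f : Fin n → ℤ) → sumFin (λ z → I x z * f z) ≡ f x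
sumFin-δˡ {suc n} zero f =
  trans (cong₂ _+_ (ℤ.*-identityˡ (f zero)) (sumFin-0 {n})) (ℤ.+-identityʳ (f zero))
sumFin-δˡ {suc n} (suc x) f =
  trans (ℤ.+-identityˡ _)
        (trans (sumFin-cong (λ z → cong (_* f (suc z)) (I-suc x z))) (sumFin-δˡ x (f ∘ suc)))

sumFin-δʳ : ∀ {n} (x : Fin n) (f : Fin n → ℤ) → sumFin (λ z → f z * I z x) ≡ f x
sumFin-δʳ x f = trans (sumFin-cong (λ z → trans (ℤ.*-comm (f z) _) (cong (_* f z) (I-sym z x))))
                      (sumFin-δˡ x f)

sumFin-I : ∀ {n} (x : Fin n) → sumFin (I x) ≡ 1ℤ
sumFin-I x = trans (sumFin-cong (λ z → sym (ℤ.*-identityʳ (I x z)))) (sumFin-δˡ x (λ _ → 1ℤ))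

-- Matrix algebra

≐-refl : ∀ {n} {A : Mat n} → A ≐ A
≐-refl _ _ = refl

≐-sym : ∀ {n} {A B : Mat n} → A ≐ B → B ≐ A
≐-sym A≐B i j = sym (A≐B i j)

≐-trans : ∀ {n} {A B C : Mat n} → A ≐ B → B ≐ C → A ≐ C
≐-trans A≐B B≐C i j = trans (A≐B i j) (B≐C i j)

≐-setoid : ℕ → Setoid 0ℓ 0ℓ
≐-setoid n = record
  { Carrier       = Mat n
  ; _≈_           = _≐_
  ; isEquivalence = record { refl = ≐-refl ; sym = ≐-sym ; trans = ≐-trans }
  }

⊕-cong : ∀ {n} {A A′ B B′ : Mat n} → A ≐ A′ → B ≐ B′ → A ⊕ B ≐ A′ ⊕ B′
⊕-cong A≐A′ B≐B′ i j = cong₂ _+_ (A≐A′ i j) (B≐B′ i j)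

⊕-comm : ∀ {n} (A B : Mat n) → A ⊕ B ≐ B ⊕ A
⊕-comm A B i j = ℤ.+-comm (A i j) (B i j)

·-congˡ : ∀ {n} c {A B : Mat n} → A ≐ B → c · A ≐ c · B
·-congˡ c A≐B i j = cong (c *_) (A≐B i j)

transpose-cong : ∀ {n} {A B : Mat n} → A ≐ B → transpose A ≐ transpose B
transpose-cong A≐B i j = A≐B j i

⊗-congˡ : ∀ {n} (A : Mat n) {B B′ : Mat n} → B ≐ B′ → A ⊗ B ≐ A ⊗ B′
⊗-congˡ A B≐B′ i j = sumFin-cong (λ k → cong (A i k *_) (B≐B′ k j))

⊗-congʳ : ∀ {n} (B : Mat n) {A A′ : Mat n} → A ≐ A′ → A ⊗ B ≐ A′ ⊗ B
⊗-congʳ B A≐A′ i j = sumFin-cong (λ k → cong (_* B k j) (A≐A′ i k))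

⊗-assoc : ∀ {n} (A B C : Mat n) → (A ⊗ B) ⊗ C ≐ A ⊗ (B ⊗ C)
⊗-assoc A B C i j = begin
  sumFin (λ k → sumFin (λ l → A i l * B l k) * C k j)
    ≡⟨ sumFin-cong (λ k → sumFin-*ʳ (C k j) (λ l → A i l * B l k)) ⟨
  sumFin (λ k → sumFin (λ l → A i l * B l k * C k j))
    ≡⟨ sumFin-swap (λ k l → A i l * B l k * C k j) ⟩
  sumFin (λ l → sumFin (λ k → A i l * B l k * C k j))
    ≡⟨ sumFin-cong (λ l → sumFin-cong (λ k → ℤ.*-assoc (A i l) (B l k) (C k j))) ⟩
  sumFin (λ l → sumFin (λ k → A i l * (B l k * C k j)))
    ≡⟨ sumFin-cong (λ l → sumFin-*ˡ (A i l) (λ k → B l k * C k j)) ⟩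
  sumFin (λ l → A i l * sumFin (λ k → B l k * C k j)) ∎
  where open ≡-Reasoning

⊗-distribˡ-⊕ : ∀ {n} (A B C : Mat n) → A ⊗ (B ⊕ C) ≐ A ⊗ B ⊕ A ⊗ C
⊗-distribˡ-⊕ A B C i j =
  trans (sumFin-cong (λ k → ℤ.*-distribˡ-+ (A i k) (B k j) (C k j)))
        (sumFin-+ (λ k → A i k * B k j) (λ k → A i k * C k j))

⊗-distribʳ-⊕ : ∀ {n} (A B C : Mat n) → (A ⊕ B) ⊗ C ≐ A ⊗ C ⊕ B ⊗ C
⊗-distribʳ-⊕ A B C i j =
  trans (sumFin-cong (λ k → ℤ.*-distribʳ-+ (C k j) (A i k) (B i k)))
        (sumFin-+ (λ k → A i k * C k j) (λ k → B i k * C k j))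

·-⊗-assoc : ∀ {n} c (A B : Mat n) → (c · A) ⊗ B ≐ c · (A ⊗ B)
·-⊗-assoc c A B i j =
  trans (sumFin-cong (λ k → ℤ.*-assoc c (A i k) (B k j))) (sumFin-*ˡ c (λ k → A i k * B k j))

transpose-⊗ : ∀ {n} (A B : Mat n) → transpose (A ⊗ B) ≐ transpose B ⊗ transpose A
transpose-⊗ A B i j = sumFin-cong (λ k → ℤ.*-comm (A j k) (B k i))

⊗-identityʳ : ∀ {n} (A : Mat n) → A ⊗ I ≐ A
⊗-identityʳ A i j = sumFin-δʳ j (A i)

bits-disjoint : ∀ {a b : ℤ} → a ≡ 0ℤ ⊎ a ≡ 1ℤ → b ≡ 0ℤ ⊎ b ≡ 1ℤ → 1ℤ + a + b ≡ 1ℤ → a ≡ 0ℤ × b ≡ 0ℤ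
bits-disjoint (inj₁ refl) (inj₁ refl) _  = refl , refl
bits-disjoint (inj₁ refl) (inj₂ refl) ()
bits-disjoint (inj₂ refl) (inj₁ refl) ()
bits-disjoint (inj₂ refl) (inj₂ refl) ()

bit-square : ∀ {a : ℤ} → a ≡ 0ℤ ⊎ a ≡ 1ℤ → a * a ≡ a
bit-square (inj₁ refl) = refl
bit-square (inj₂ refl) = refl

sumMat-3 : ∀ {n} (A : Fin 3 → Mat n) → sumMat A ≐ A 0F ⊕ A 1F ⊕ A 2F
sumMat-3 A i j = trans (cong (λ t → A 0F i j + (A 1F i j + t)) (ℤ.+-identityʳ (A 2F i j)))
                       (sym (ℤ.+-assoc (A 0F i j) (A 1F i j) (A 2F i j)))

⊗-transpose-diag : ∀ {n} {A : Mat n} → IsZeroOne A → ∀ x → (A ⊗ transpose A) x x ≡ sumFin (A x)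
⊗-transpose-diag zeroOne x = sumFin-cong (λ z → bit-square (zeroOne x z))

rowSum-⊗ : ∀ {n} (A B : Mat n) {r} → (∀ z → sumFin (B z) ≡ r) → ∀ x → sumFin ((A ⊗ B) x) ≡ sumFin (A x) * r
rowSum-⊗ A B {r} rows x = begin
  sumFin (λ y → sumFin (λ z → A x z * B z y))  ≡⟨ sumFin-swap (λ y z → A x z * B z y) ⟩
  sumFin (λ z → sumFin (λ y → A x z * B z y))  ≡⟨ sumFin-cong (λ z → sumFin-*ˡ (A x z) (B z)) ⟩
  sumFin (λ z → A x z * sumFin (B z))          ≡⟨ sumFin-cong (λ z → cong (_*_ (A x z)) (rows z)) ⟩
  sumFin (λ z → A x z * r)                     ≡⟨ sumFin-*ʳ r (A x) ⟩
  sumFin (A x) * r                             ∎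
  where open ≡-Reasoning

-- Integer arithmetic

half-pred : ∀ m c → + m ≡ 1ℤ + (c + c) → + ((m ∸ 1) / 2) ≡ c
half-pred m (+ n) eq = cong +_ (begin
  (m ∸ 1) / 2     ≡⟨ cong (λ t → (t ∸ 1) / 2) (ℤ.+-injective eq) ⟩
  (n ℕ.+ n) / 2   ≡⟨ cong (λ t → (n ℕ.+ t) / 2) (ℕ.+-identityʳ n) ⟨
  2 ℕ.* n / 2     ≡⟨ cong (_/ 2) (ℕ.*-comm 2 n) ⟩
  n ℕ.* 2 / 2     ≡⟨ m*n/n≡m n 2 ⟩
  n               ∎)
  where open ≡-Reasoning
half-pred m -[1+ n ] ()

cross-cancel : ∀ u c d a b → u + c * a + d * b ≡ u + c * b + d * a → (c - d) * (a - b) ≡ 0ℤ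
cross-cancel u c d a b eq = begin
  (c - d) * (a - b)                                     ≡⟨ expand u c d a b ⟩
  (u + c * a + d * b) - (u + c * b + d * a)             ≡⟨ cong (_- (u + c * b + d * a)) eq ⟩
  (u + c * b + d * a) - (u + c * b + d * a)             ≡⟨ ℤ.+-inverseʳ (u + c * b + d * a) ⟩
  0ℤ                                                    ∎
  where
  open ≡-Reasoning
  expand : ∀ u c d a b → (c - d) * (a - b) ≡ (u + c * a + d * b) - (u + c * b + d * a)
  expand = solve-∀

factor-valency : ∀ {k l : ℤ} → k * k ≡ k * 1ℤ + l * k + l * k → k * (k - (1ℤ + (l + l))) ≡ 0ℤ
factor-valency {k} {l} eq = begin
  k * (k - (1ℤ + (l + l)))                             ≡⟨ expand k l ⟩
  k * k - (k * 1ℤ + l * k + l * k)                     ≡⟨ cong (_- (k * 1ℤ + l * k + l * k)) eq ⟩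
  (k * 1ℤ + l * k + l * k) - (k * 1ℤ + l * k + l * k)  ≡⟨ ℤ.+-inverseʳ (k * 1ℤ + l * k + l * k) ⟩
  0ℤ                                                   ∎
  where
  open ≡-Reasoning
  expand : ∀ k l → k * (k - (1ℤ + (l + l))) ≡ k * k - (k * 1ℤ + l * k + l * k)
  expand = solve-∀

products-arith : ∀ {n k l i a b : ℤ} → n ≡ 1ℤ + (k + k) → k ≡ 1ℤ + (l + l) →
                 (k * i + l * a + l * b) + (k * i + l * a + l * b) + (i + a + b) ≡ k * (a + b) + n * i
products-arith {l = l} {i} {a} {b} refl refl = identity l i a b
  where
  identity : ∀ l i a b → let k = 1ℤ + (l + l) in
             (k * i + l * a + l * b) + (k * i + l * a + l * b) + (i + a + b) ≡ k * (a + b) + (1ℤ + (k + k)) * i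
  identity = solve-∀

squares-arith : ∀ {k l i a b u v : ℤ} → k ≡ 1ℤ + (l + l) → i ≡ 1ℤ - (a + b) →
                (u + (k * i + l * a + l * b)) + ((k * i + l * a + l * b) + v) + (a + b) ≡ k + k →
                u + v ≡ k * (a + b)
squares-arith {l = l} {a = a} {b} {u} {v} refl refl total = begin
  u + v                                           ≡⟨ isolate u v w (a + b) ⟩
  (u + w) + (w + v) + (a + b) - (w + w) - (a + b) ≡⟨ cong (λ t → t - (w + w) - (a + b)) total ⟩
  (k + k) - (w + w) - (a + b)                     ≡⟨ closing l a b ⟩
  k * (a + b)                                     ∎
  where
  open ≡-Reasoning
  k = 1ℤ + (l + l)
  w = k * (1ℤ - (a + b)) + l * a + l * b
  isolate : ∀ u v w s → u + v ≡ (u + w) + (w + v) + s - (w + w) - s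
  isolate = solve-∀
  closing : ∀ l a b → let k = 1ℤ + (l + l); w = k * (1ℤ - (a + b)) + l * a + l * b in
            (k + k) - (w + w) - (a + b) ≡ k * (a + b)
  closing = solve-∀

-- Non-symmetric 2-class schemes

Fin1-unique : ∀ {n} → n ≡ 1 → (x y : Fin n) → x ≡ y
Fin1-unique refl zero zero = refl

-- The identities of a doubly regular tournament A₁ (of order m and valency k, with A₂ = A₁ᵀ)
-- that the block computation uses.
record IsDoublyRegular (m : ℕ) (k : ℤ) (A₁ A₂ : Mat m) : Set where
  field
    transposed : A₂ ≐ transpose A₁
    partition  : I ⊕ A₁ ⊕ A₂ ≐ J
    rowSum₁    : ∀ x → sumFin (A₁ x) ≡ k
    rowSum₂    : ∀ x → sumFin (A₂ x) ≡ k
    squares    : A₁ ⊗ A₁ ⊕ A₂ ⊗ A₂ ≐ k · (A₁ ⊕ A₂)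
    products   : A₁ ⊗ A₂ ⊕ A₂ ⊗ A₁ ⊕ J ≐ k · (A₁ ⊕ A₂) ⊕ + m · I

module FromScheme {m : ℕ} {A : Fin 3 → Mat m} (scheme : IsAssocScheme m 2 A)
                  (nonSymmetric : NonSymmetric A) (A₂≐A₁ᵀ : A 2F ≐ transpose (A 1F)) (x₀ : Fin m) where
  open IsAssocScheme scheme

  private
    A₁ A₂ : Mat m
    A₁ = A 1F
    A₂ = A 2F
    p : Fin 3 → ℤ
    p = proj₁ (mulClosed 1F 2F)
    p₀ p₁ p₂ : ℤ
    p₀ = p 0F
    p₁ = p 1F
    p₂ = p 2F

  partition : I ⊕ A₁ ⊕ A₂ ≐ J
  partition x y = trans (cong (λ e → e + A₁ x y + A₂ x y) (sym (identity x y)))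
                        (trans (sym (sumMat-3 A x y)) (sumJ x y))

  diagonal : ∀ x → A₁ x x ≡ 0ℤ × A₂ x x ≡ 0ℤ
  diagonal x = bits-disjoint (zeroOne 1F x x) (zeroOne 2F x x)
    (trans (cong (λ e → e + A₁ x x + A₂ x x) (sym (I-diag x))) (partition x x))

  A₁-asymmetric : ¬ (transpose A₁ ≐ A₁)
  A₁-asymmetric A₁ᵀ≐A₁ = proj₂ nonSymmetric (symmetric (proj₁ nonSymmetric))
    where
    symmetric : ∀ i → transpose (A i) ≐ A i
    symmetric 0F x y = trans (identity y x) (trans (I-sym y x) (sym (identity x y)))
    symmetric 1F     = A₁ᵀ≐A₁
    symmetric 2F x y = trans (A₂≐A₁ᵀ y x) (trans (A₁ᵀ≐A₁ y x) (sym (A₂≐A₁ᵀ x y)))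

  A₁A₂ : A₁ ⊗ A₂ ≐ p₀ · I ⊕ p₁ · A₁ ⊕ p₂ · A₂
  A₁A₂ x y = trans (proj₂ (mulClosed 1F 2F) x y)
    (trans (sumMat-3 (λ i → p i · A i) x y) (cong (λ e → p₀ * e + p₁ * A₁ x y + p₂ * A₂ x y) (identity x y)))

  A₁A₂-symmetric : transpose (A₁ ⊗ A₂) ≐ A₁ ⊗ A₂
  A₁A₂-symmetric = ≐-trans (transpose-⊗ A₁ A₂)
    (≐-trans (⊗-congʳ (transpose A₁) (λ x y → A₂≐A₁ᵀ y x)) (⊗-congˡ A₁ (≐-sym A₂≐A₁ᵀ)))

  A₁A₂-diag : ∀ x → (A₁ ⊗ A₂) x x ≡ p₀
  A₁A₂-diag x = begin
    (A₁ ⊗ A₂) x x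
      ≡⟨ A₁A₂ x x ⟩
    p₀ * I x x + p₁ * A₁ x x + p₂ * A₂ x x
      ≡⟨ cong₂ (λ a b → p₀ * I x x + p₁ * a + p₂ * b) (proj₁ (diagonal x)) (proj₂ (diagonal x)) ⟩
    p₀ * I x x + p₁ * 0ℤ + p₂ * 0ℤ
      ≡⟨ cong (λ e → p₀ * e + p₁ * 0ℤ + p₂ * 0ℤ) (I-diag x) ⟩
    p₀ * 1ℤ + p₁ * 0ℤ + p₂ * 0ℤ
      ≡⟨ drop p₀ p₁ p₂ ⟩
    p₀ ∎
    where
    open ≡-Reasoning
    drop : ∀ a b c → a * 1ℤ + b * 0ℤ + c * 0ℤ ≡ a
    drop = solve-∀

  p₁≡p₂ : p₁ ≡ p₂
  p₁≡p₂ with p₁ ℤ.≟ p₂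
  ... | yes p₁≡p₂ = p₁≡p₂
  ... | no p₁≢p₂ = contradiction A₁-symmetric A₁-asymmetric
    where
    swapped : ∀ x y → p₀ * I x y + p₁ * A₁ y x + p₂ * A₁ x y ≡ p₀ * I x y + p₁ * A₁ x y + p₂ * A₁ y x
    swapped x y = begin
      p₀ * I x y + p₁ * A₁ y x + p₂ * A₁ x y
        ≡⟨ cong₂ (λ e a → p₀ * e + p₁ * A₁ y x + p₂ * a) (I-sym y x) (A₂≐A₁ᵀ y x) ⟨
      p₀ * I y x + p₁ * A₁ y x + p₂ * A₂ y x
        ≡⟨ A₁A₂ y x ⟨
      (A₁ ⊗ A₂) y x
        ≡⟨ A₁A₂-symmetric x y ⟩
      (A₁ ⊗ A₂) x y
        ≡⟨ A₁A₂ x y ⟩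
      p₀ * I x y + p₁ * A₁ x y + p₂ * A₂ x y
        ≡⟨ cong (λ a → p₀ * I x y + p₁ * A₁ x y + p₂ * a) (A₂≐A₁ᵀ x y) ⟩
      p₀ * I x y + p₁ * A₁ x y + p₂ * A₁ y x ∎
      where open ≡-Reasoning
    A₁-symmetric : transpose A₁ ≐ A₁
    A₁-symmetric x y with ℤ.i*j≡0⇒i≡0∨j≡0 (p₁ - p₂) (cross-cancel (p₀ * I x y) p₁ p₂ (A₁ y x) (A₁ x y) (swapped x y))
    ... | inj₁ p₁-p₂≡0 = contradiction (ℤ.i-j≡0⇒i≡j p₁ p₂ p₁-p₂≡0) p₁≢p₂
    ... | inj₂ a-b≡0   = ℤ.i-j≡0⇒i≡j (A₁ y x) (A₁ x y) a-b≡0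

  rowSum₁ : ∀ x → sumFin (A₁ x) ≡ p₀
  rowSum₁ x = begin
    sumFin (A₁ x)              ≡⟨ ⊗-transpose-diag (zeroOne 1F) x ⟨
    (A₁ ⊗ transpose A₁) x x    ≡⟨ ⊗-congˡ A₁ A₂≐A₁ᵀ x x ⟨
    (A₁ ⊗ A₂) x x              ≡⟨ A₁A₂-diag x ⟩
    p₀                         ∎
    where open ≡-Reasoning

  rowSum₂ : ∀ x → sumFin (A₂ x) ≡ p₀
  rowSum₂ x = begin
    sumFin (A₂ x)              ≡⟨ ⊗-transpose-diag (zeroOne 2F) x ⟨
    (A₂ ⊗ transpose A₂) x x    ≡⟨ ⊗-congˡ A₂ (λ y z → A₂≐A₁ᵀ z y) x x ⟩
    (A₂ ⊗ A₁) x x              ≡⟨ commutative 1F 2F x x ⟨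
    (A₁ ⊗ A₂) x x              ≡⟨ A₁A₂-diag x ⟩
    p₀                         ∎
    where open ≡-Reasoning

  m≡1+2p₀ : + m ≡ 1ℤ + (p₀ + p₀)
  m≡1+2p₀ = begin
    + m
      ≡⟨ sumFin-1 {m} ⟨
    sumFin {m} (λ _ → 1ℤ)
      ≡⟨ sumFin-cong (partition x₀) ⟨
    sumFin (λ z → I x₀ z + A₁ x₀ z + A₂ x₀ z)
      ≡⟨ sumFin-+ (λ z → I x₀ z + A₁ x₀ z) (A₂ x₀) ⟩
    sumFin (λ z → I x₀ z + A₁ x₀ z) + sumFin (A₂ x₀)
      ≡⟨ cong (_+ sumFin (A₂ x₀)) (sumFin-+ (I x₀) (A₁ x₀)) ⟩
    sumFin (I x₀) + sumFin (A₁ x₀) + sumFin (A₂ x₀)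
      ≡⟨ cong₂ (λ a b → a + b + sumFin (A₂ x₀)) (sumFin-I x₀) (rowSum₁ x₀) ⟩
    1ℤ + p₀ + sumFin (A₂ x₀)
      ≡⟨ cong (_+_ (1ℤ + p₀)) (rowSum₂ x₀) ⟩
    1ℤ + p₀ + p₀
      ≡⟨ ℤ.+-assoc 1ℤ p₀ p₀ ⟩
    1ℤ + (p₀ + p₀) ∎
    where open ≡-Reasoning

  rowSum-A₁A₂ : p₀ * p₀ ≡ p₀ * 1ℤ + p₁ * p₀ + p₁ * p₀
  rowSum-A₁A₂ = begin
    p₀ * p₀
      ≡⟨ cong (_* p₀) (rowSum₁ x₀) ⟨
    sumFin (A₁ x₀) * p₀
      ≡⟨ rowSum-⊗ A₁ A₂ rowSum₂ x₀ ⟨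
    sumFin ((A₁ ⊗ A₂) x₀)
      ≡⟨ sumFin-cong (A₁A₂ x₀) ⟩
    sumFin (λ y → p₀ * I x₀ y + p₁ * A₁ x₀ y + p₂ * A₂ x₀ y)
      ≡⟨ sumFin-+ (λ y → p₀ * I x₀ y + p₁ * A₁ x₀ y) (λ y → p₂ * A₂ x₀ y) ⟩
    sumFin (λ y → p₀ * I x₀ y + p₁ * A₁ x₀ y) + sumFin (λ y → p₂ * A₂ x₀ y)
      ≡⟨ cong₂ _+_ (sumFin-+ (λ y → p₀ * I x₀ y) (λ y → p₁ * A₁ x₀ y)) (sumFin-*ˡ p₂ (A₂ x₀)) ⟩
    sumFin (λ y → p₀ * I x₀ y) + sumFin (λ y → p₁ * A₁ x₀ y) + p₂ * sumFin (A₂ x₀)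
      ≡⟨ cong₂ (λ a b → a + b + p₂ * sumFin (A₂ x₀)) (sumFin-*ˡ p₀ (I x₀)) (sumFin-*ˡ p₁ (A₁ x₀)) ⟩
    p₀ * sumFin (I x₀) + p₁ * sumFin (A₁ x₀) + p₂ * sumFin (A₂ x₀)
      ≡⟨ cong₂ (λ a b → p₀ * a + p₁ * b + p₂ * sumFin (A₂ x₀)) (sumFin-I x₀) (rowSum₁ x₀) ⟩
    p₀ * 1ℤ + p₁ * p₀ + p₂ * sumFin (A₂ x₀)
      ≡⟨ cong₂ (λ c r → p₀ * 1ℤ + p₁ * p₀ + c * r) (sym p₁≡p₂) (rowSum₂ x₀) ⟩
    p₀ * 1ℤ + p₁ * p₀ + p₁ * p₀ ∎
    where open ≡-Reasoning

  -- p₀ = 0 would force m = 1, where every matrix is symmetric.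
  p₀≡1+2p₁ : p₀ ≡ 1ℤ + (p₁ + p₁)
  p₀≡1+2p₁ with ℤ.i*j≡0⇒i≡0∨j≡0 p₀ (factor-valency {p₀} {p₁} rowSum-A₁A₂)
  ... | inj₁ p₀≡0 = contradiction (λ y z → cong₂ A₁ (Fin1-unique m≡1 z y) (Fin1-unique m≡1 y z)) A₁-asymmetric
    where
    m≡1 : m ≡ 1
    m≡1 = ℤ.+-injective (trans m≡1+2p₀ (cong (λ e → 1ℤ + (e + e)) p₀≡0))
  ... | inj₂ eq = ℤ.i-j≡0⇒i≡j p₀ (1ℤ + (p₁ + p₁)) eq

  valency : + ((m ∸ 1) / 2) ≡ p₀
  valency = half-pred m p₀ m≡1+2p₀

  A₁A₂-expansion : ∀ x y → (A₁ ⊗ A₂) x y ≡ p₀ * I x y + p₁ * A₁ x y + p₁ * A₂ x y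
  A₁A₂-expansion x y = trans (A₁A₂ x y) (cong (λ c → p₀ * I x y + p₁ * A₁ x y + c * A₂ x y) (sym p₁≡p₂))

  A₂A₁-expansion : ∀ x y → (A₂ ⊗ A₁) x y ≡ p₀ * I x y + p₁ * A₁ x y + p₁ * A₂ x y
  A₂A₁-expansion x y = trans (sym (commutative 1F 2F x y)) (A₁A₂-expansion x y)

  products : A₁ ⊗ A₂ ⊕ A₂ ⊗ A₁ ⊕ J ≐ p₀ · (A₁ ⊕ A₂) ⊕ + m · I
  products x y = begin
    (A₁ ⊗ A₂) x y + (A₂ ⊗ A₁) x y + 1ℤ
      ≡⟨ cong (_+_ ((A₁ ⊗ A₂) x y + (A₂ ⊗ A₁) x y)) (partition x y) ⟨
    (A₁ ⊗ A₂) x y + (A₂ ⊗ A₁) x y + (I x y + A₁ x y + A₂ x y)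
      ≡⟨ cong₂ (λ u v → u + v + (I x y + A₁ x y + A₂ x y)) (A₁A₂-expansion x y) (A₂A₁-expansion x y) ⟩
    W + W + (I x y + A₁ x y + A₂ x y)
      ≡⟨ products-arith {l = p₁} {I x y} {A₁ x y} {A₂ x y} m≡1+2p₀ p₀≡1+2p₁ ⟩
    p₀ * (A₁ x y + A₂ x y) + + m * I x y ∎
    where
    open ≡-Reasoning
    W = p₀ * I x y + p₁ * A₁ x y + p₁ * A₂ x y

  private
    S : Mat m
    S = A₁ ⊕ A₂

  S⊗S⊕S : S ⊗ S ⊕ S ≐ S ⊗ J
  S⊗S⊕S = ≐-trans (⊕-cong (≐-refl {A = S ⊗ S}) (≐-sym (⊗-identityʳ S)))
         (≐-trans (≐-sym (⊗-distribˡ-⊕ S S I)) (⊗-congˡ S S⊕I≐J))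
    where
    S⊕I≐J : S ⊕ I ≐ J
    S⊕I≐J x y = trans (ℤ.+-comm (S x y) (I x y)) (trans (sym (ℤ.+-assoc (I x y) (A₁ x y) (A₂ x y))) (partition x y))

  S⊗J : ∀ x y → (S ⊗ J) x y ≡ p₀ + p₀
  S⊗J x y = trans (sumFin-cong (λ z → ℤ.*-identityʳ (S x z)))
                  (trans (sumFin-+ (A₁ x) (A₂ x)) (cong₂ _+_ (rowSum₁ x) (rowSum₂ x)))

  S⊗S-expansion : ∀ x y → (S ⊗ S) x y ≡ ((A₁ ⊗ A₁) x y + (A₂ ⊗ A₁) x y) + ((A₁ ⊗ A₂) x y + (A₂ ⊗ A₂) x y)
  S⊗S-expansion x y = trans (⊗-distribˡ-⊕ S A₁ A₂ x y)
    (cong₂ _+_ (⊗-distribʳ-⊕ A₁ A₂ A₁ x y) (⊗-distribʳ-⊕ A₁ A₂ A₂ x y))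

  complement : ∀ x y → I x y ≡ 1ℤ - (A₁ x y + A₂ x y)
  complement x y = trans (isolate (I x y) (A₁ x y) (A₂ x y))
                         (cong (_- (A₁ x y + A₂ x y)) (partition x y))
    where
    isolate : ∀ i a b → i ≡ i + a + b - (a + b)
    isolate = solve-∀

  squares : A₁ ⊗ A₁ ⊕ A₂ ⊗ A₂ ≐ p₀ · (A₁ ⊕ A₂)
  squares x y = squares-arith {l = p₁} {u = (A₁ ⊗ A₁) x y} {v = (A₂ ⊗ A₂) x y}
                              p₀≡1+2p₁ (complement x y) (begin
    ((A₁ ⊗ A₁) x y + W) + (W + (A₂ ⊗ A₂) x y) + S x y
      ≡⟨ cong₂ (λ u v → ((A₁ ⊗ A₁) x y + u) + (v + (A₂ ⊗ A₂) x y) + S x y) (A₂A₁-expansion x y) (A₁A₂-expansion x y) ⟨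
    ((A₁ ⊗ A₁) x y + (A₂ ⊗ A₁) x y) + ((A₁ ⊗ A₂) x y + (A₂ ⊗ A₂) x y) + S x y
      ≡⟨ cong (_+ S x y) (S⊗S-expansion x y) ⟨
    (S ⊗ S) x y + S x y
      ≡⟨ S⊗S⊕S x y ⟩
    (S ⊗ J) x y
      ≡⟨ S⊗J x y ⟩
    p₀ + p₀ ∎)
    where
    open ≡-Reasoning
    W = p₀ * I x y + p₁ * A₁ x y + p₁ * A₂ x y

  isDoublyRegular : IsDoublyRegular m p₀ A₁ A₂
  isDoublyRegular = record
    { transposed = A₂≐A₁ᵀ
    ; partition  = partition
    ; rowSum₁    = rowSum₁
    ; rowSum₂    = rowSum₂
    ; squares    = squares
    ; products   = products
    }

-- The block construction

module Blocks (m : ℕ) where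

  unblock : Block m → Fin (N m)
  unblock bA     = zero
  unblock (bB x) = suc (x ↑ˡ (m ℕ.+ 1))
  unblock (bC y) = suc (m ↑ʳ (y ↑ˡ 1))
  unblock bD     = suc (m ↑ʳ (m ↑ʳ zero))

  block-unblock : ∀ p → block (unblock p) ≡ p
  block-unblock bA = refl
  block-unblock (bB x) rewrite splitAt-↑ˡ m x (m ℕ.+ 1) = refl
  block-unblock (bC y) rewrite splitAt-↑ʳ m (m ℕ.+ 1) (y ↑ˡ 1) | splitAt-↑ˡ m y 1 = refl
  block-unblock bD rewrite splitAt-↑ʳ m (m ℕ.+ 1) (m ↑ʳ zero) | splitAt-↑ʳ m 1 zero = refl

  splitAt≡⇒join≡ : ∀ {n} {i : Fin (m ℕ.+ n)} {s} → splitAt m i ≡ s → join m n s ≡ i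
  splitAt≡⇒join≡ {n} {i} eq = trans (cong (join m n) (sym eq)) (join-splitAt m n i)

  unblock-block : ∀ i → unblock (block i) ≡ i
  unblock-block zero = refl
  unblock-block (suc i) with splitAt m i in eq₁
  ... | inj₁ x = cong suc (splitAt≡⇒join≡ eq₁)
  ... | inj₂ l with splitAt m l in eq₂
  ...   | inj₁ y    = cong suc (trans (cong (m ↑ʳ_) (splitAt≡⇒join≡ eq₂)) (splitAt≡⇒join≡ eq₁))
  ...   | inj₂ zero = cong suc (trans (cong (m ↑ʳ_) (splitAt≡⇒join≡ eq₂)) (splitAt≡⇒join≡ eq₁))

  block-injective : ∀ {i j} → block i ≡ block j → i ≡ j
  block-injective {i} {j} eq =
    trans (sym (unblock-block i)) (trans (cong unblock eq) (unblock-block j))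

  blockSum : (Block m → ℤ) → ℤ
  blockSum g = g bA + (sumFin (g ∘ bB) + (sumFin (g ∘ bC) + g bD))

  sumFin-block : ∀ (g : Block m → ℤ) → sumFin (g ∘ block) ≡ blockSum g
  sumFin-block g = cong (_+_ (g bA)) (begin
    sumFin (λ i → g (block (suc i)))
      ≡⟨ sumFin-↑ m (m ℕ.+ 1) (λ i → g (block (suc i))) ⟩
    sumFin (λ x → g (block (unblock (bB x)))) + sumFin (λ l → g (block (suc (m ↑ʳ l))))
      ≡⟨ cong₂ _+_ (sumFin-cong (cong g ∘ block-unblock ∘ bB))
                   (sumFin-↑ m 1 (λ l → g (block (suc (m ↑ʳ l))))) ⟩
    sumFin (g ∘ bB) + (sumFin (λ y → g (block (unblock (bC y)))) + (g (block (unblock bD)) + 0ℤ))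
      ≡⟨ cong (_+_ (sumFin (g ∘ bB))) (cong₂ _+_ (sumFin-cong (cong g ∘ block-unblock ∘ bC))
                                                 (trans (ℤ.+-identityʳ _) (cong g (block-unblock bD)))) ⟩
    sumFin (g ∘ bB) + (sumFin (g ∘ bC) + g bD) ∎)
    where open ≡-Reasoning

  blockSum-onlyB : ∀ g → g bA ≡ 0ℤ → (∀ z → g (bC z) ≡ 0ℤ) → g bD ≡ 0ℤ → blockSum g ≡ sumFin (g ∘ bB)
  blockSum-onlyB g gA≡0 gC≡0 gD≡0 = begin
    g bA + (sumFin (g ∘ bB) + (sumFin (g ∘ bC) + g bD))
      ≡⟨ cong₂ (λ a c → a + (sumFin (g ∘ bB) + c)) gA≡0 (cong₂ _+_ (trans (sumFin-cong gC≡0) (sumFin-0 {m})) gD≡0) ⟩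
    0ℤ + (sumFin (g ∘ bB) + 0ℤ)
      ≡⟨ trans (ℤ.+-identityˡ _) (ℤ.+-identityʳ _) ⟩
    sumFin (g ∘ bB) ∎
    where open ≡-Reasoning

  blockSum-onlyC : ∀ g → g bA ≡ 0ℤ → (∀ z → g (bB z) ≡ 0ℤ) → g bD ≡ 0ℤ → blockSum g ≡ sumFin (g ∘ bC)
  blockSum-onlyC g gA≡0 gB≡0 gD≡0 = begin
    g bA + (sumFin (g ∘ bB) + (sumFin (g ∘ bC) + g bD))
      ≡⟨ cong₂ (λ a b → a + (b + (sumFin (g ∘ bC) + g bD))) gA≡0 (trans (sumFin-cong gB≡0) (sumFin-0 {m})) ⟩
    0ℤ + (0ℤ + (sumFin (g ∘ bC) + g bD))
      ≡⟨ trans (ℤ.+-identityˡ _) (trans (ℤ.+-identityˡ _) (trans (cong (_+_ (sumFin (g ∘ bC))) gD≡0) (ℤ.+-identityʳ _))) ⟩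
    sumFin (g ∘ bC) ∎
    where open ≡-Reasoning

  δ : Block m → Block m → ℤ
  δ bA     bA     = 1ℤ
  δ (bB x) (bB y) = I x y
  δ (bC x) (bC y) = I x y
  δ bD     bD     = 1ℤ
  δ _      _      = 0ℤ

  δ-refl : ∀ p → δ p p ≡ 1ℤ
  δ-refl bA     = refl
  δ-refl (bB x) = I-diag x
  δ-refl (bC x) = I-diag x
  δ-refl bD     = refl

  δ-apart : ∀ {p q} → p ≢ q → δ p q ≡ 0ℤ
  δ-apart {bA}   {bA}   p≢q = contradiction refl p≢q
  δ-apart {bA}   {bB _} _   = refl
  δ-apart {bA}   {bC _} _   = refl
  δ-apart {bA}   {bD}   _   = refl
  δ-apart {bB _} {bA}   _   = refl
  δ-apart {bB x} {bB y} p≢q = I-offDiag (p≢q ∘ cong bB)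
  δ-apart {bB _} {bC _} _   = refl
  δ-apart {bB _} {bD}   _   = refl
  δ-apart {bC _} {bA}   _   = refl
  δ-apart {bC _} {bB _} _   = refl
  δ-apart {bC x} {bC y} p≢q = I-offDiag (p≢q ∘ cong bC)
  δ-apart {bC _} {bD}   _   = refl
  δ-apart {bD}   {bA}   _   = refl
  δ-apart {bD}   {bB _} _   = refl
  δ-apart {bD}   {bC _} _   = refl
  δ-apart {bD}   {bD}   p≢q = contradiction refl p≢q

  I-block : ∀ i j → I i j ≡ δ (block i) (block j)
  I-block i j with i ≟ j
  ... | yes refl = sym (δ-refl (block i))
  ... | no i≢j   = sym (δ-apart (i≢j ∘ block-injective))

  δ-unblock : ∀ p j → δ p (block j) ≡ I (unblock p) j
  δ-unblock p j = trans (cong (λ q → δ q (block j)) (sym (block-unblock p))) (sym (I-block (unblock p) j))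

  mirror : Block m → Block m
  mirror bA     = bD
  mirror (bB x) = bC x
  mirror (bC x) = bB x
  mirror bD     = bA

  mirror-involutive : ∀ p → mirror (mirror p) ≡ p
  mirror-involutive bA     = refl
  mirror-involutive (bB _) = refl
  mirror-involutive (bC _) = refl
  mirror-involutive bD     = refl

  reflect : Fin (N m) → Fin (N m)
  reflect = unblock ∘ mirror ∘ block

  reflect-involutive : ∀ i → reflect (reflect i) ≡ i
  reflect-involutive i = begin
    unblock (mirror (block (unblock (mirror (block i))))) ≡⟨ cong (unblock ∘ mirror) (block-unblock _) ⟩
    unblock (mirror (mirror (block i)))                   ≡⟨ cong unblock (mirror-involutive _) ⟩
    unblock (block i)                                     ≡⟨ unblock-block i ⟩
    i                                                     ∎
    where open ≡-Reasoning

C3-symmetric : ∀ {m} (A₁ A₂ : Mat m) → transpose (C3 A₁ A₂) ≐ C3 A₁ A₂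
C3-symmetric A₁ A₂ i j = begin
  1ℤ - I j i - C1 A₁ A₂ j i - C1 A₁ A₂ i j  ≡⟨ cong (λ e → 1ℤ - e - C1 A₁ A₂ j i - C1 A₁ A₂ i j) (I-sym j i) ⟩
  1ℤ - I i j - C1 A₁ A₂ j i - C1 A₁ A₂ i j  ≡⟨ swap-subtrahends (1ℤ - I i j) (C1 A₁ A₂ j i) (C1 A₁ A₂ i j) ⟩
  1ℤ - I i j - C1 A₁ A₂ i j - C1 A₁ A₂ j i  ∎
  where
  open ≡-Reasoning
  swap-subtrahends : ∀ a b c → a - b - c ≡ a - c - b
  swap-subtrahends = solve-∀

module Construction {m : ℕ} {k : ℤ} {A₁ A₂ : Mat m} (D : IsDoublyRegular m k A₁ A₂) where
  open IsDoublyRegular D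
  open Blocks m

  private
    M : ℤ
    M = + m
    Cb : Block m → Block m → ℤ
    Cb = C1blk A₁ A₂
    c₁ c₂ c₃ : Mat (N m)
    c₁ = C1 A₁ A₂
    c₂ = C2 A₁ A₂
    c₃ = C3 A₁ A₂

  colSum₁ : ∀ y → sumFin (λ x → A₁ x y) ≡ k
  colSum₁ y = trans (sumFin-cong (λ x → sym (transposed y x))) (rowSum₂ y)

  colSum₂ : ∀ y → sumFin (λ x → A₂ x y) ≡ k
  colSum₂ y = trans (sumFin-cong (λ x → transposed x y)) (rowSum₁ y)

  complement-within : ∀ x y → 1ℤ - I x y - A₁ x y - A₁ y x ≡ 0ℤ
  complement-within x y = begin
    1ℤ - I x y - A₁ x y - A₁ y x
      ≡⟨ cong₂ (λ e a → e - I x y - A₁ x y - a) (sym (partition x y)) (sym (transposed x y)) ⟩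
    I x y + A₁ x y + A₂ x y - I x y - A₁ x y - A₂ x y
      ≡⟨ cancel (I x y) (A₁ x y) (A₂ x y) ⟩
    0ℤ ∎
    where
    open ≡-Reasoning
    cancel : ∀ i a b → i + a + b - i - a - b ≡ 0ℤ
    cancel = solve-∀

  complement-across : ∀ x y → 1ℤ - A₂ x y - A₂ y x ≡ I x y
  complement-across x y = begin
    1ℤ - A₂ x y - A₂ y x
      ≡⟨ cong₂ (λ e a → e - A₂ x y - a) (sym (partition x y)) (transposed y x) ⟩
    I x y + A₁ x y + A₂ x y - A₂ x y - A₁ x y
      ≡⟨ cancel (I x y) (A₁ x y) (A₂ x y) ⟩
    I x y ∎
    where
    open ≡-Reasoning
    cancel : ∀ i a b → i + a + b - b - a ≡ i
    cancel = solve-∀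

  C₃-block : ∀ p q → 1ℤ - δ p q - Cb p q - Cb q p ≡ δ (mirror p) q
  C₃-block bA     bA     = refl
  C₃-block bA     (bB _) = refl
  C₃-block bA     (bC _) = refl
  C₃-block bA     bD     = refl
  C₃-block (bB _) bA     = refl
  C₃-block (bB x) (bB y) = complement-within x y
  C₃-block (bB x) (bC y) = complement-across x y
  C₃-block (bB _) bD     = refl
  C₃-block (bC _) bA     = refl
  C₃-block (bC x) (bB y) = complement-across x y
  C₃-block (bC x) (bC y) = complement-within x y
  C₃-block (bC _) bD     = refl
  C₃-block bD     bA     = refl
  C₃-block bD     (bB _) = refl
  C₃-block bD     (bC _) = refl
  C₃-block bD     bD     = refl

  Cb-mirrorˡ : ∀ p q → Cb (mirror p) q ≡ Cb q p
  Cb-mirrorˡ bA     bA     = refl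
  Cb-mirrorˡ bA     (bB _) = refl
  Cb-mirrorˡ bA     (bC _) = refl
  Cb-mirrorˡ bA     bD     = refl
  Cb-mirrorˡ (bB _) bA     = refl
  Cb-mirrorˡ (bB x) (bB y) = transposed x y
  Cb-mirrorˡ (bB x) (bC y) = sym (transposed y x)
  Cb-mirrorˡ (bB _) bD     = refl
  Cb-mirrorˡ (bC _) bA     = refl
  Cb-mirrorˡ (bC x) (bB y) = sym (transposed y x)
  Cb-mirrorˡ (bC x) (bC y) = transposed x y
  Cb-mirrorˡ (bC _) bD     = refl
  Cb-mirrorˡ bD     bA     = refl
  Cb-mirrorˡ bD     (bB _) = refl
  Cb-mirrorˡ bD     (bC _) = refl
  Cb-mirrorˡ bD     bD     = refl

  Cb-mirrorʳ : ∀ p q → Cb q (mirror p) ≡ Cb p q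
  Cb-mirrorʳ p q = trans (sym (Cb-mirrorˡ (mirror p) q)) (cong (λ r → Cb r q) (mirror-involutive p))

  C₃-δ : ∀ i j → c₃ i j ≡ δ (mirror (block i)) (block j)
  C₃-δ i j = trans (cong (λ e → 1ℤ - e - c₁ i j - c₂ i j) (I-block i j)) (C₃-block (block i) (block j))

  C₃-reflect : ∀ i j → c₃ i j ≡ I (reflect i) j
  C₃-reflect i j = trans (C₃-δ i j) (δ-unblock (mirror (block i)) j)

  C₃-⊗ : ∀ (X : Mat (N m)) i j → (c₃ ⊗ X) i j ≡ X (reflect i) j
  C₃-⊗ X i j = trans (sumFin-cong (λ l → cong (_* X l j) (C₃-reflect i l))) (sumFin-δˡ (reflect i) (λ l → X l j))

  C₃C₁ : c₃ ⊗ c₁ ≐ c₂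
  C₃C₁ i j = trans (C₃-⊗ c₁ i j)
    (trans (cong (λ p → Cb p (block j)) (block-unblock (mirror (block i)))) (Cb-mirrorˡ (block i) (block j)))

  C₃C₂ : c₃ ⊗ c₂ ≐ c₁
  C₃C₂ i j = trans (C₃-⊗ c₂ i j)
    (trans (cong (Cb (block j)) (block-unblock (mirror (block i)))) (Cb-mirrorʳ (block i) (block j)))

  C₃C₃ : c₃ ⊗ c₃ ≐ C0 {m}
  C₃C₃ i j = trans (C₃-⊗ c₃ i j) (trans (C₃-reflect (reflect i) j) (cong (λ l → I l j) (reflect-involutive i)))

  private
    row-bA-picks-bB : ∀ q → blockSum (λ r → Cb bA r * Cb r q) ≡ sumFin (λ z → Cb (bB z) q)
    row-bA-picks-bB q = trans (blockSum-onlyB (λ r → Cb bA r * Cb r q) refl (λ _ → refl) refl)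
                              (sumFin-cong (λ z → ℤ.*-identityˡ (Cb (bB z) q)))

    row-bD-picks-bC : ∀ q → blockSum (λ r → Cb bD r * Cb r q) ≡ sumFin (λ z → Cb (bC z) q)
    row-bD-picks-bC q = trans (blockSum-onlyC (λ r → Cb bD r * Cb r q) refl (λ _ → refl) refl)
                              (sumFin-cong (λ z → ℤ.*-identityˡ (Cb (bC z) q)))

    col-bA-picks-bC : ∀ p → blockSum (λ r → Cb p r * Cb r bA) ≡ sumFin (λ z → Cb p (bC z))
    col-bA-picks-bC p = trans (blockSum-onlyC (λ r → Cb p r * Cb r bA)
                                (ℤ.*-zeroʳ (Cb p bA)) (λ z → ℤ.*-zeroʳ (Cb p (bB z))) (ℤ.*-zeroʳ (Cb p bD)))
                              (sumFin-cong (λ z → ℤ.*-identityʳ (Cb p (bC z))))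

    col-bD-picks-bB : ∀ p → blockSum (λ r → Cb p r * Cb r bD) ≡ sumFin (λ z → Cb p (bB z))
    col-bD-picks-bB p = trans (blockSum-onlyB (λ r → Cb p r * Cb r bD)
                                (ℤ.*-zeroʳ (Cb p bA)) (λ z → ℤ.*-zeroʳ (Cb p (bC z))) (ℤ.*-zeroʳ (Cb p bD)))
                              (sumFin-cong (λ z → ℤ.*-identityʳ (Cb p (bB z))))

  squares-entry : ∀ x y → (A₁ ⊗ A₁) x y + (A₂ ⊗ A₂) x y ≡ k * (A₁ x y + A₁ y x) + M * 0ℤ
  squares-entry x y = begin
    (A₁ ⊗ A₁) x y + (A₂ ⊗ A₂) x y ≡⟨ squares x y ⟩
    k * (A₁ x y + A₂ x y)         ≡⟨ cong (λ a → k * (A₁ x y + a)) (transposed x y) ⟩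
    k * (A₁ x y + A₁ y x)         ≡⟨ ℤ.+-identityʳ _ ⟨
    k * (A₁ x y + A₁ y x) + 0ℤ    ≡⟨ cong (_+_ (k * (A₁ x y + A₁ y x))) (ℤ.*-zeroʳ M) ⟨
    k * (A₁ x y + A₁ y x) + M * 0ℤ ∎
    where open ≡-Reasoning

  products-entry : ∀ x y → (A₁ ⊗ A₂) x y + (A₂ ⊗ A₁) x y + 1ℤ ≡ k * (A₂ x y + A₂ y x) + M * I x y
  products-entry x y = begin
    (A₁ ⊗ A₂) x y + (A₂ ⊗ A₁) x y + 1ℤ ≡⟨ products x y ⟩
    k * (A₁ x y + A₂ x y) + M * I x y   ≡⟨ cong (λ s → k * s + M * I x y) (ℤ.+-comm (A₁ x y) (A₂ x y)) ⟩
    k * (A₂ x y + A₁ x y) + M * I x y   ≡⟨ cong (λ a → k * (A₂ x y + a) + M * I x y) (transposed y x) ⟨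
    k * (A₂ x y + A₂ y x) + M * I x y   ∎
    where open ≡-Reasoning

  private
    only-k : ∀ a b → a ≡ a * 1ℤ + b * 0ℤ
    only-k = solve-∀
    only-M : ∀ a b → b ≡ a * 0ℤ + b * 1ℤ
    only-M = solve-∀
    neither : ∀ a b → 0ℤ ≡ a * 0ℤ + b * 0ℤ
    neither = solve-∀
    shuffle-BB : ∀ u v → 0ℤ + (u + (v + 0ℤ)) ≡ u + v
    shuffle-BB = solve-∀
    shuffle-BC : ∀ u v → 0ℤ + (u + (v + 1ℤ)) ≡ u + v + 1ℤ
    shuffle-BC = solve-∀
    shuffle-CB : ∀ u v → 1ℤ + (v + (u + 0ℤ)) ≡ u + v + 1ℤ
    shuffle-CB = solve-∀
    shuffle-CC : ∀ u v → 0ℤ + (v + (u + 0ℤ)) ≡ u + v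
    shuffle-CC = solve-∀

  C₁²-block : ∀ p q → blockSum (λ r → Cb p r * Cb r q) ≡ k * (Cb p q + Cb q p) + M * δ (mirror p) q
  C₁²-block bA     bA     = trans (row-bA-picks-bB bA) (trans (sumFin-0 {m}) (neither k M))
  C₁²-block bA     (bB y) = trans (row-bA-picks-bB (bB y)) (trans (colSum₁ y) (only-k k M))
  C₁²-block bA     (bC y) = trans (row-bA-picks-bB (bC y)) (trans (colSum₂ y) (only-k k M))
  C₁²-block bA     bD     = trans (row-bA-picks-bB bD) (trans (sumFin-1 {m}) (only-M k M))
  C₁²-block (bB x) bA     = trans (col-bA-picks-bC (bB x)) (trans (rowSum₂ x) (only-k k M))
  C₁²-block (bB x) (bB y) = trans (shuffle-BB ((A₁ ⊗ A₁) x y) ((A₂ ⊗ A₂) x y)) (squares-entry x y)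
  C₁²-block (bB x) (bC y) = trans (shuffle-BC ((A₁ ⊗ A₂) x y) ((A₂ ⊗ A₁) x y)) (products-entry x y)
  C₁²-block (bB x) bD     = trans (col-bD-picks-bB (bB x)) (trans (rowSum₁ x) (only-k k M))
  C₁²-block (bC x) bA     = trans (col-bA-picks-bC (bC x)) (trans (rowSum₁ x) (only-k k M))
  C₁²-block (bC x) (bB y) = trans (shuffle-CB ((A₁ ⊗ A₂) x y) ((A₂ ⊗ A₁) x y)) (products-entry x y)
  C₁²-block (bC x) (bC y) = trans (shuffle-CC ((A₁ ⊗ A₁) x y) ((A₂ ⊗ A₂) x y)) (squares-entry x y)
  C₁²-block (bC x) bD     = trans (col-bD-picks-bB (bC x)) (trans (rowSum₂ x) (only-k k M))
  C₁²-block bD     bA     = trans (row-bD-picks-bC bA) (trans (sumFin-1 {m}) (only-M k M))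
  C₁²-block bD     (bB y) = trans (row-bD-picks-bC (bB y)) (trans (colSum₂ y) (only-k k M))
  C₁²-block bD     (bC y) = trans (row-bD-picks-bC (bC y)) (trans (colSum₁ y) (only-k k M))
  C₁²-block bD     bD     = trans (row-bD-picks-bC bD) (trans (sumFin-0 {m}) (neither k M))

  C₁C₁ : c₁ ⊗ c₁ ≐ k · (c₁ ⊕ c₂) ⊕ M · c₃
  C₁C₁ i j = trans (sumFin-block (λ r → Cb (block i) r * Cb r (block j)))
    (trans (C₁²-block (block i) (block j)) (cong (λ e → k * (c₁ i j + c₂ i j) + M * e) (sym (C₃-δ i j))))

  open import Relation.Binary.Reasoning.Setoid (≐-setoid (N m))

  C₂C₂ : c₂ ⊗ c₂ ≐ k · (c₁ ⊕ c₂) ⊕ M · c₃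
  C₂C₂ = begin
    c₂ ⊗ c₂                          ≈⟨ transpose-⊗ c₁ c₁ ⟨
    transpose (c₁ ⊗ c₁)              ≈⟨ transpose-cong C₁C₁ ⟩
    k · (c₂ ⊕ c₁) ⊕ M · transpose c₃ ≈⟨ ⊕-cong (·-congˡ k (⊕-comm c₂ c₁)) (·-congˡ M (C3-symmetric A₁ A₂)) ⟩
    k · (c₁ ⊕ c₂) ⊕ M · c₃           ∎

  C₁C₃ : c₁ ⊗ c₃ ≐ c₂
  C₁C₃ = begin
    c₁ ⊗ c₃             ≈⟨ ⊗-congˡ c₁ (C3-symmetric A₁ A₂) ⟨
    c₁ ⊗ transpose c₃   ≈⟨ transpose-⊗ c₃ c₂ ⟨
    transpose (c₃ ⊗ c₂) ≈⟨ transpose-cong C₃C₂ ⟩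
    c₂                  ∎

  C₂C₃ : c₂ ⊗ c₃ ≐ c₁
  C₂C₃ = begin
    c₂ ⊗ c₃             ≈⟨ ⊗-congˡ c₂ (C3-symmetric A₁ A₂) ⟨
    c₂ ⊗ transpose c₃   ≈⟨ transpose-⊗ c₃ c₁ ⟨
    transpose (c₃ ⊗ c₁) ≈⟨ transpose-cong C₃C₁ ⟩
    c₁                  ∎

  square-⊗-C₃ : ∀ {X} → X ≐ k · (c₁ ⊕ c₂) ⊕ M · c₃ → X ⊗ c₃ ≐ M · C0 {m} ⊕ k · (c₁ ⊕ c₂)
  square-⊗-C₃ {X} X≐ = begin
    X ⊗ c₃
      ≈⟨ ⊗-congʳ c₃ X≐ ⟩
    (k · (c₁ ⊕ c₂) ⊕ M · c₃) ⊗ c₃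
      ≈⟨ ⊗-distribʳ-⊕ (k · (c₁ ⊕ c₂)) (M · c₃) c₃ ⟩
    k · (c₁ ⊕ c₂) ⊗ c₃ ⊕ M · c₃ ⊗ c₃
      ≈⟨ ⊕-cong (·-⊗-assoc k (c₁ ⊕ c₂) c₃) (·-⊗-assoc M c₃ c₃) ⟩
    k · ((c₁ ⊕ c₂) ⊗ c₃) ⊕ M · (c₃ ⊗ c₃)
      ≈⟨ ⊕-cong (·-congˡ k (⊗-distribʳ-⊕ c₁ c₂ c₃)) (·-congˡ M C₃C₃) ⟩
    k · (c₁ ⊗ c₃ ⊕ c₂ ⊗ c₃) ⊕ M · C0 {m}
      ≈⟨ ⊕-cong (·-congˡ k (≐-trans (⊕-cong C₁C₃ C₂C₃) (⊕-comm c₂ c₁))) ≐-refl ⟩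
    k · (c₁ ⊕ c₂) ⊕ M · C0 {m}
      ≈⟨ ⊕-comm (k · (c₁ ⊕ c₂)) (M · C0 {m}) ⟩
    M · C0 {m} ⊕ k · (c₁ ⊕ c₂) ∎

  C₁C₂ : c₁ ⊗ c₂ ≐ M · C0 {m} ⊕ k · (c₁ ⊕ c₂)
  C₁C₂ = begin
    c₁ ⊗ c₂         ≈⟨ ⊗-congˡ c₁ C₁C₃ ⟨
    c₁ ⊗ (c₁ ⊗ c₃)  ≈⟨ ⊗-assoc c₁ c₁ c₃ ⟨
    (c₁ ⊗ c₁) ⊗ c₃  ≈⟨ square-⊗-C₃ C₁C₁ ⟩
    M · C0 {m} ⊕ k · (c₁ ⊕ c₂) ∎

  C₂C₁ : c₂ ⊗ c₁ ≐ M · C0 {m} ⊕ k · (c₁ ⊕ c₂)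
  C₂C₁ = begin
    c₂ ⊗ c₁         ≈⟨ ⊗-congˡ c₂ C₂C₃ ⟨
    c₂ ⊗ (c₂ ⊗ c₃)  ≈⟨ ⊗-assoc c₂ c₂ c₃ ⟨
    (c₂ ⊗ c₂) ⊗ c₃  ≈⟨ square-⊗-C₃ C₂C₂ ⟩
    M · C0 {m} ⊕ k · (c₁ ⊕ c₂) ∎

lemma3p3 : (m : ℕ) → 1 ≤ m → (A : Fin 3 → Mat m) →
    IsAssocScheme m 2 A → NonSymmetric A →
    A (suc (suc zero)) ≐ transpose (A (suc zero)) →
    let A₁ = A (suc zero)
        A₂ = A (suc (suc zero))
        c₁ = C1 A₁ A₂
        c₂ = C2 A₁ A₂
        c₃ = C3 A₁ A₂
        h  = + ((m ∸ 1) / 2)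
        M  = + m
    in (c₁ ⊗ c₁ ≐ h · (c₁ ⊕ c₂) ⊕ M · c₃)
     × (c₂ ⊗ c₂ ≐ h · (c₁ ⊕ c₂) ⊕ M · c₃)
     × (c₁ ⊗ c₂ ≐ M · C0 {m} ⊕ h · (c₁ ⊕ c₂))
     × (c₂ ⊗ c₁ ≐ M · C0 {m} ⊕ h · (c₁ ⊕ c₂))
     × (c₁ ⊗ c₃ ≐ c₂) × (c₃ ⊗ c₁ ≐ c₂)
     × (c₂ ⊗ c₃ ≐ c₁) × (c₃ ⊗ c₂ ≐ c₁)
     × (c₃ ⊗ c₃ ≐ C0 {m})
lemma3p3 m 1≤m A scheme nonSymmetric A₂≐A₁ᵀ =
  C₁C₁ , C₂C₂ , C₁C₂ , C₂C₁ , C₁C₃ , C₃C₁ , C₂C₃ , C₃C₂ , C₃C₃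
  where
  open FromScheme scheme nonSymmetric A₂≐A₁ᵀ (fromℕ< 1≤m)
  open Construction (subst (λ k → IsDoublyRegular m k (A 1F) (A 2F)) (sym valency) isDoublyRegular)
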